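{- Let $S$ be an $R$-fold rotationally symmetric connected unpseudoknotted secondary structure with strand ordering $\pi$, where $R\ge2$. Then there exists a single loop of $S$, called the central loop, that is not contained in any of the $R$ symmetric slices of $\mathrm{Poly}(S,\pi)$. If $R>2$ then the central loop is a multiloop; if $R=2$ then the central loop is either a multiloop, a stack, or an internal loop.
   Context: Strands are words over $\{\mathrm{A},\mathrm{C},\mathrm{G},\mathrm{T}\}$; strands with identical sequences have the same type. A circular strand ordering $\pi$ is a cyclic string over strand types; $v(\pi)$ is the largest $n$ with $\pi=y^n$ for a prefix $y$; $X^n_m$ denotes the $m$-th strand of type $X$ in the $n$-th copy of the shortest such prefix. The $N$ bases are placed on a circle in order $\pi$ (each strand $5'\to3'$). A secondary structure $S$ is a set of base pairs (complementary bases, each base in at most one pair); $\mathrm{Poly}(S,\pi)$ has covalent bonds (consecutive bases of the same strand) as arcs and base pairs as chords. $S$ is unpseudoknotted if no chords cross, connected if $\mathrm{Poly}(S,\pi)$ is connected. Let $G^\pi$ be the cyclic group generated by the rotation sending base $i$ of $X^n_m$ to base $i$ of $X^{n+1\bmod v(\pi)}_m$; $S$ is $R$-fold rotationally symmetric if the largest subgroup $H\le G^\pi$ leaving $S$ invariant has order $R$. For a covalent bond $b$, $\mathcal{C}^b_R=\{a(b):a\in H\}$ with $|H|=R$; it is admissible for $S$ if no bond of it lies within the shorter circular arc $[\![i,j]\!]$ between the endpoints of any base pair $(i,j)\in S$. Such a cut exists, and removing its $R$ bonds from $\mathrm{Poly}(S,\pi)$ leaves exactly $R$ isomorphic connected components;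 each is a symmetric slice. Loops are the faces of the planar drawing of $\mathrm{Poly}(S,\pi)$ bounded by base pairs and backbone: a hairpin loop is bordered by one base pair; a stack, bulge or internal (interior) loop is bordered by exactly two base pairs and contains no nick (stack: no unpaired bases; bulge: unpaired bases on one side only; internal: on both sides); a multiloop is bordered by more than two base pairs and contains no nick; an exterior loop contains a nick. -}

module Defs where

open import Data.Nat using (ℕ; zero; suc; _+_; _*_; _∸_; _≤_; _<_; _/_; _≤ᵇ_; NonZero)
open import Data.Nat.DivMod using (_%_; m%n<n)
open import Data.Nat.Divisibility using (_∣_)
open import Data.Fin using (Fin; toℕ; fromℕ<)
import Data.Fin as F
open import Data.List using (List; []; _∷_; length; concat; replicate; lookup)
open import Data.List.Membership.Propositional using (_∉_)
open import Data.List.Relation.Unary.All using (All)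
open import Data.Maybe using (Maybe; just; nothing)
import Data.Maybe as M
open import Data.Bool using (if_then_else_)
open import Data.Product using (Σ; ∃; _×_; _,_)
open import Data.Sum using (_⊎_)
open import Data.Empty using (⊥)
open import Relation.Nullary using (¬_)
open import Relation.Binary.PropositionalEquality using (_≡_; _≢_)
open import Relation.Binary.Construct.Closure.ReflexiveTransitive using (Star)

data Base : Set where
  A C G T : Base

data Complementary : Base → Base → Set where
  AT : Complementary A T
  TA : Complementary T A
  CG : Complementary C G
  GC : Complementary G C

-- a strand (type) is a word over {A,C,G,T}, read 5' → 3'
Strand : Set
Strand = List Base

-- a circular strand ordering, given by a linear representative
Ordering : Set
Ordering = List Strand

IsPower : Ordering → ℕ → Set
IsPower π n = 1 ≤ n × ∃ λ (y : Ordering) → π ≡ concat (replicate n y)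

IsV : Ordering → ℕ → Set
IsV π v = IsPower π v × (∀ n → IsPower π n → n ≤ v)

-- total number of bases N; bases are numbered 0..N-1 around the circle
len : Ordering → ℕ
len π = length (concat π)

Pos : Ordering → Set
Pos π = Fin (len π)

baseAt : (π : Ordering) → Pos π → Base
baseAt π i = lookup (concat π) i

startsFrom : ℕ → Ordering → List ℕ
startsFrom acc [] = []
startsFrom acc (s ∷ π) = acc ∷ startsFrom (acc + length s) π

rot : ∀ {N} → ℕ → Fin N → Fin N
rot {zero} k ()
rot {suc n} k i = fromℕ< (m%n<n (toℕ i + k) (suc n))

next : ∀ {N} → Fin N → Fin N
next = rot 1

prev : ∀ {N} → Fin N → Fin N
prev {N} = rot (N ∸ 1)

cw : ∀ {N} → Fin N → Fin N → ℕ
cw {N} i k = if toℕ i ≤ᵇ toℕ k then toℕ k ∸ toℕ i else (N ∸ toℕ i) + toℕ k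

quot : ℕ → ℕ → ℕ
quot n zero = 0
quot n (suc d) = n / suc d

-- covalent bonds.  "Gap p" is the circle segment between base p and
-- base p+1 (mod N).  It carries a covalent bond iff p and p+1 are
-- consecutive bases of the same strand; otherwise it is a nick.

IsBond : (π : Ordering) → Pos π → Set
IsBond π p = suc (toℕ p) < len π × suc (toℕ p) ∉ startsFrom 0 π

record SecStruct (π : Ordering) : Set where
  field
    partner : Pos π → Maybe (Pos π)
    sym     : ∀ i j → partner i ≡ just j → partner j ≡ just i
    irrefl  : ∀ i j → partner i ≡ just j → i ≢ j
    compl   : ∀ i j → partner i ≡ just j → Complementary (baseAt π i) (baseAt π j)
open SecStruct public

Paired : ∀ {π} → SecStruct π → Pos π → Pos π → Set
Paired S i j = partner S i ≡ just j

Unpseudoknotted : ∀ {π} → SecStruct π → Set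
Unpseudoknotted S = ∀ i j k l → Paired S i j → Paired S k l →
  ¬ ((i F.< k) × (k F.< j) × (j F.< l))

-- edges of Poly(S,π) minus a set `cut` of covalent bonds (given by gaps)
data Adj {π : Ordering} (S : SecStruct π) (cut : Pos π → Set) : Pos π → Pos π → Set where
  bondʳ : ∀ p → IsBond π p → ¬ cut p → Adj S cut p (next p)
  bondˡ : ∀ p → IsBond π p → ¬ cut p → Adj S cut (next p) p
  pair  : ∀ i j → Paired S i j → Adj S cut i j

NoCut : ∀ {π} → Pos π → Set
NoCut _ = ⊥

Connected : ∀ {π} → SecStruct π → Set
Connected {π} S = ∀ p q → Star (Adj S (NoCut {π})) p q

-- number of bases in the shortest prefix y (π = y^v): the generator of
-- G^π is the rotation by this many bases
genStep : Ordering → ℕ → ℕ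
genStep π v = quot (len π) v

Invariant : ∀ {π} → SecStruct π → ℕ → Set
Invariant S k = ∀ i → partner S (rot k i) ≡ M.map (rot k) (partner S i)

-- for d ∣ v, the unique subgroup of order d of the cyclic group G^π
-- (of order v, generated by g) is { g^(j·(v/d)) : j < d }, i.e. the
-- rotations by j·(v/d)·genStep bases, j < d.
SubgroupInvariant : ∀ {π} → SecStruct π → ℕ → ℕ → Set
SubgroupInvariant {π} S v d = ∀ j → j < d → Invariant S (j * quot v d * genStep π v)

-- the largest subgroup of G^π leaving S invariant has order R
RFold : ∀ {π} → SecStruct π → ℕ → ℕ → Set
RFold S v R = R ∣ v × SubgroupInvariant S v R ×
  (∀ d → d ∣ v → SubgroupInvariant S v d → d ≤ R)

-- rotation by one generator of the subgroup H of order R (= N/R bases)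
hStep : Ordering → ℕ → ℕ → ℕ
hStep π v R = quot v R * genStep π v

-- q ∈ C^b_R  (gaps are identified with the bonds they carry)
CutBond : (π : Ordering) → ℕ → ℕ → Pos π → Pos π → Set
CutBond π v R b q = ∃ λ j → j < R × q ≡ rot (j * hStep π v R) b

-- the bond at gap q lies within the shorter circular arc [[i,k]]
-- (an arc of length ≤ N/2; if both arcs have length N/2 both count)
InShortArc : ∀ {π} → Pos π → Pos π → Pos π → Set
InShortArc {π} q i k =
    (2 * cw i k ≤ len π × cw i q < cw i k)
  ⊎ (2 * cw k i ≤ len π × cw k q < cw k i)

Admissible : ∀ {π} → SecStruct π → ℕ → ℕ → Pos π → Set
Admissible {π} S v R b = IsBond π b ×
  (∀ q → CutBond π v R b q → ∀ i k → Paired S i k → ¬ InShortArc {π} q i k)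

-- loops.  A loop (face / disk region) is represented by any gap on
-- its boundary; two gaps belong to the same loop iff no base pair
-- separates them.

Inside : ∀ {N} → Fin N → Fin N → Fin N → Set
Inside i j p = (i F.≤ p) × (p F.< j)

Separated : ∀ {π} → SecStruct π → Pos π → Pos π → Set
Separated S g q = ∃ λ i → ∃ λ j → Paired S i j × (i F.< j) ×
  ((Inside i j g × ¬ Inside i j q) ⊎ (¬ Inside i j g × Inside i j q))

SameLoop : ∀ {π} → SecStruct π → Pos π → Pos π → Set
SameLoop S g q = ¬ Separated S g q

HasNick : ∀ {π} → SecStruct π → Pos π → Set
HasNick {π} S g = ∃ λ q → SameLoop S g q × ¬ IsBond π q

-- the base pair with smaller endpoint i borders the loop of g
-- (the two faces beside chord (i,j) contain gaps i and i-1)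
Borders : ∀ {π} → SecStruct π → Pos π → Pos π → Set
Borders S g i = ∃ λ j → Paired S i j × (i F.< j) ×
  (SameLoop S g i ⊎ SameLoop S g (prev i))

ExactlyTwoPairs : ∀ {π} → SecStruct π → Pos π → Set
ExactlyTwoPairs S g = ∃ λ i₁ → ∃ λ i₂ → i₁ ≢ i₂ × Borders S g i₁ × Borders S g i₂ ×
  (∀ i → Borders S g i → i ≡ i₁ ⊎ i ≡ i₂)

MoreThanTwoPairs : ∀ {π} → SecStruct π → Pos π → Set
MoreThanTwoPairs S g = ∃ λ i₁ → ∃ λ i₂ → ∃ λ i₃ →
  i₁ ≢ i₂ × i₁ ≢ i₃ × i₂ ≢ i₃ × Borders S g i₁ × Borders S g i₂ × Borders S g i₃

UnpairedIn : ∀ {π} → SecStruct π → Pos π → Pos π → Set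
UnpairedIn S g p = partner S p ≡ nothing × SameLoop S g p

-- p and q lie on the same side of the loop: the bases from p
-- clockwise to q (or from q to p) are all unpaired bases of the loop
RunCW : ∀ {π} → SecStruct π → Pos π → Pos π → Pos π → Set
RunCW S g p q = ∃ λ k → rot k p ≡ q × (∀ t → t ≤ k → UnpairedIn S g (rot t p))

SameSide : ∀ {π} → SecStruct π → Pos π → Pos π → Pos π → Set
SameSide S g p q = RunCW S g p q ⊎ RunCW S g q p

Multiloop : ∀ {π} → SecStruct π → Pos π → Set
Multiloop S g = MoreThanTwoPairs S g × ¬ HasNick S g

Stack : ∀ {π} → SecStruct π → Pos π → Set
Stack S g = ExactlyTwoPairs S g × ¬ HasNick S g × (∀ p → ¬ UnpairedIn S g p)

InternalLoop : ∀ {π} → SecStruct π → Pos π → Set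
InternalLoop S g = ExactlyTwoPairs S g × ¬ HasNick S g ×
  ∃ λ p → ∃ λ q → UnpairedIn S g p × UnpairedIn S g q × ¬ SameSide S g p q

-- the loop of g is contained in a symmetric slice (a connected
-- component of Poly(S,π) minus the cut C^b_R): none of its boundary
-- bonds is cut and all its boundary bases lie in one component
InSlice : ∀ {π} → SecStruct π → ℕ → ℕ → Pos π → Pos π → Set
InSlice {π} S v R b g = ∃ λ c → ∀ q → SameLoop S g q →
  ¬ CutBond π v R b q ×
  Star (Adj S (CutBond π v R b)) c q × Star (Adj S (CutBond π v R b)) c (next q)

{-# OPTIONS --safe #-}
module Submission where

-- Call a gap central if it lies on no short arc (at most N/2 bases) cut off by a chord. Central
-- gaps all lie in one loop, the central loop; every other gap lies on a short arc, so its loop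
-- stays on one side of an admissible cut and lies in a slice. A central gap exists: from any
-- chord, passing to a short chord that covers the current endpoint strictly lengthens the short
-- arc. This needs that no chord has length exactly N/2: such a chord would pair a base with its
-- own half-turn image (R = 2) or cross its image under the rotation by N/R (R > 2).
-- That rotation maps the central loop to itself. Hence the loop has no nick (the image of a nick
-- would be a second nick of the same loop, impossible in a connected structure), and the images
-- of a chord bordering it border it too: three distinct ones if R > 2. If R = 2 and the loop has
-- exactly two borders, an unpaired base and its half-turn image lie on different sides.

open import Defs hiding (sym)
open import Data.Bool using (true; false)
open import Data.Empty using (⊥; ⊥-elim)
open import Data.Fin as F using (Fin; toℕ; fromℕ<)
open import Data.Fin.Properties using (toℕ-fromℕ<; toℕ-injective; toℕ<n)
import Data.Fin.Properties as FP
open import Data.List using (List; []; _∷_; length; concat; replicate; lookup; _++_; map)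
open import Data.List.Membership.Propositional using (_∈_)
open import Data.List.Membership.Propositional.Properties using (∈-++⁺ˡ; ∈-++⁺ʳ; ∈-++⁻; ∈-map⁺; ∈-map⁻)
open import Data.List.Properties using (length-++; concat-concat; map-replicate)
open import Data.List.Relation.Unary.All using (All; _∷_)
open import Data.List.Relation.Unary.All.Properties using (++⁻ˡ)
open import Data.List.Relation.Unary.Any using (here; there)
open import Data.Maybe as Maybe using (Maybe; just; nothing)
open import Data.Maybe.Properties as MP using (just-injective)
open import Data.Nat hiding (Ordering)
open import Data.Nat.DivMod
open import Data.Nat.Divisibility using (_∣_; divides; ∣⇒≤)
open import Data.Nat.Properties
open import Data.List.Membership.DecPropositional _≟_ using (_∈?_)
open import Data.Product using (∃; _×_; _,_; proj₁; proj₂)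
open import Data.Sum as Sum using (_⊎_; inj₁; inj₂)
open import Function using (id; _∘_)
open import Relation.Binary using (tri<; tri≈; tri>)
open import Relation.Binary.Construct.Closure.ReflexiveTransitive as Star using (Star; ε; _◅_; _◅◅_)
open import Relation.Binary.PropositionalEquality
open import Relation.Nullary using (¬_; Dec; yes; no)
open import Relation.Nullary.Decidable using (_×-dec_; _⊎-dec_; ¬?; decidable-stable)

-- Arithmetic

[m%n+k]%n≡[m+k]%n : ∀ m k n .{{_ : NonZero n}} → (m % n + k) % n ≡ (m + k) % n
[m%n+k]%n≡[m+k]%n m k n = begin
  (m % n + k) % n          ≡⟨ %-distribˡ-+ (m % n) k n ⟩
  (m % n % n + k % n) % n  ≡⟨ cong (λ z → (z + k % n) % n) (m%n%n≡m%n m n) ⟩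
  (m % n + k % n) % n      ≡⟨ %-distribˡ-+ m k n ⟨
  (m + k) % n              ∎
  where open ≡-Reasoning

[k+n]%k≡n%k : ∀ k n .{{_ : NonZero k}} → (k + n) % k ≡ n % k
[k+n]%k≡n%k k n = trans (cong (_% k) (+-comm k n)) ([m+n]%n≡m%n n k)

suc-%-cong : ∀ {m n} k .{{_ : NonZero k}} → m % k ≡ n % k → suc m % k ≡ suc n % k
suc-%-cong {m} {n} k m≡n = begin
  suc m % k        ≡⟨ cong (_% k) (+-comm 1 m) ⟩
  (m + 1) % k      ≡⟨ [m%n+k]%n≡[m+k]%n m 1 k ⟨
  (m % k + 1) % k  ≡⟨ cong (λ r → (r + 1) % k) m≡n ⟩
  (n % k + 1) % k  ≡⟨ [m%n+k]%n≡[m+k]%n n 1 k ⟩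
  (n + 1) % k      ≡⟨ cong (_% k) (+-comm n 1) ⟩
  suc n % k        ∎
  where open ≡-Reasoning

[m+n]%n-cases : ∀ m n k .{{_ : NonZero k}} → m < k → n < k →
  ((m + n) % k ≡ m + n × m + n < k) ⊎ ((m + n) % k + k ≡ m + n)
[m+n]%n-cases m n k m<k n<k with k ≤? m + n
... | no k≰m+n = inj₁ (m<n⇒m%n≡m (≰⇒> k≰m+n) , ≰⇒> k≰m+n)
... | yes k≤m+n with m≤n⇒∃[o]m+o≡n k≤m+n
... | o , k+o≡m+n = inj₂ (begin
      (m + n) % k + k  ≡⟨ cong (λ z → z % k + k) (trans (sym k+o≡m+n) (+-comm k o)) ⟩
      (o + k) % k + k  ≡⟨ cong (_+ k) (trans ([m+n]%n≡m%n o k) (m<n⇒m%n≡m o<k)) ⟩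
      o + k            ≡⟨ +-comm o k ⟩
      k + o            ≡⟨ k+o≡m+n ⟩
      m + n            ∎)
  where
  open ≡-Reasoning
  o<k : o < k
  o<k = +-cancelˡ-< k o k (subst (_< k + k) (sym k+o≡m+n) (+-mono-< m<k n<k))

2*n≡n+n : ∀ n → 2 * n ≡ n + n
2*n≡n+n n = cong (n +_) (+-identityʳ n)

m+n≡o∧2m≰o⇒2n≤o : ∀ {m n o} → m + n ≡ o → ¬ 2 * m ≤ o → 2 * n ≤ o
m+n≡o∧2m≰o⇒2n≤o {m} {n} m+n≡o 2m≰o with m ≤? n
... | yes m≤n = ⊥-elim (2m≰o (subst (2 * m ≤_) m+n≡o
      (subst (_≤ m + n) (cong (m +_) (sym (+-identityʳ m))) (+-monoʳ-≤ m m≤n))))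
... | no m≰n = subst (2 * n ≤_) (trans (+-comm n m) m+n≡o)
                 (subst (_≤ n + m) (cong (n +_) (sym (+-identityʳ n))) (+-monoʳ-≤ n (<⇒≤ (≰⇒> m≰n))))

m+n≡o∧2m≤o∧2n≤o⇒2m≡o : ∀ {m n o} → m + n ≡ o → 2 * m ≤ o → 2 * n ≤ o → 2 * m ≡ o
m+n≡o∧2m≤o∧2n≤o⇒2m≡o {m} {n} {o} m+n≡o 2m≤o 2n≤o =
  ≤-antisym 2m≤o (≮⇒≥ λ 2m<o → <-irrefl (sym o+o≡) (+-mono-<-≤ 2m<o 2n≤o))
  where
  o+o≡ : o + o ≡ 2 * m + 2 * n
  o+o≡ = trans (sym (2*n≡n+n o)) (trans (cong (2 *_) (sym m+n≡o)) (*-distribˡ-+ 2 m n))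

m+n≡k+o⇒2m≮o∨2n≰o : ∀ {m n k o} → m + n ≡ k + o → 2 * m < o → 2 * n ≤ o → ⊥
m+n≡k+o⇒2m≮o∨2n≰o {m} {n} {k} {o} wrap 2m<o 2n≤o = <⇒≱ (*-cancelˡ-< 2 (k + o) o (begin-strict
  2 * (k + o)    ≡⟨ cong (2 *_) wrap ⟨
  2 * (m + n)    ≡⟨ *-distribˡ-+ 2 m n ⟩
  2 * m + 2 * n  <⟨ +-mono-<-≤ 2m<o 2n≤o ⟩
  o + o          ≡⟨ 2*n≡n+n o ⟨
  2 * o          ∎)) (m≤n+m o k)
  where open ≤-Reasoning

Star-preserves : ∀ {A : Set} {T : A → A → Set} (P : A → Set) → (∀ {x y} → T x y → P x → P y) →
  ∀ {x y} → Star T x y → P x → P y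
Star-preserves P step = Star.fold (λ x y → P x → P y) (λ e f → f ∘ step e) id

-- Rotations and clockwise distances on Fin N

toℕ-rot : ∀ {N} .{{_ : NonZero N}} k (i : Fin N) → toℕ (rot k i) ≡ (toℕ i + k) % N
toℕ-rot {suc n} k i = toℕ-fromℕ< (m%n<n (toℕ i + k) (suc n))

rot-rot : ∀ {N} a b (x : Fin N) → rot a (rot b x) ≡ rot (b + a) x
rot-rot {suc n} a b x = toℕ-injective (begin
  toℕ (rot a (rot b x))              ≡⟨ toℕ-rot a (rot b x) ⟩
  (toℕ (rot b x) + a) % suc n        ≡⟨ cong (λ z → (z + a) % suc n) (toℕ-rot b x) ⟩
  ((toℕ x + b) % suc n + a) % suc n  ≡⟨ [m%n+k]%n≡[m+k]%n (toℕ x + b) a (suc n) ⟩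
  (toℕ x + b + a) % suc n            ≡⟨ cong (_% suc n) (+-assoc (toℕ x) b a) ⟩
  (toℕ x + (b + a)) % suc n          ≡⟨ toℕ-rot (b + a) x ⟨
  toℕ (rot (b + a) x)                ∎)
  where open ≡-Reasoning

rot-zero : ∀ {N} (x : Fin N) → rot 0 x ≡ x
rot-zero {suc n} x = toℕ-injective (begin
  toℕ (rot 0 x)          ≡⟨ toℕ-rot 0 x ⟩
  (toℕ x + 0) % suc n    ≡⟨ cong (_% suc n) (+-identityʳ (toℕ x)) ⟩
  toℕ x % suc n          ≡⟨ m<n⇒m%n≡m (toℕ<n x) ⟩
  toℕ x                  ∎)
  where open ≡-Reasoning

rot-+N : ∀ {N} k (x : Fin N) → rot (k + N) x ≡ rot k x
rot-+N {suc n} k x = toℕ-injective (begin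
  toℕ (rot (k + suc n) x)        ≡⟨ toℕ-rot (k + suc n) x ⟩
  (toℕ x + (k + suc n)) % suc n  ≡⟨ cong (_% suc n) (+-assoc (toℕ x) k (suc n)) ⟨
  (toℕ x + k + suc n) % suc n    ≡⟨ [m+n]%n≡m%n (toℕ x + k) (suc n) ⟩
  (toℕ x + k) % suc n            ≡⟨ toℕ-rot k x ⟨
  toℕ (rot k x)                  ∎)
  where open ≡-Reasoning

rot-N : ∀ {N} (x : Fin N) → rot N x ≡ x
rot-N x = trans (rot-+N 0 x) (rot-zero x)

rot-comm : ∀ {N} a b (x : Fin N) → rot a (rot b x) ≡ rot b (rot a x)
rot-comm a b x = trans (rot-rot a b x) (trans (cong (λ z → rot z x) (+-comm b a)) (sym (rot-rot b a x)))

next-prev : ∀ {N} (x : Fin N) → next (prev x) ≡ x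
next-prev {suc n} x = trans (rot-rot 1 n x) (trans (cong (λ z → rot z x) (+-comm n 1)) (rot-N x))

cw-≤ : ∀ {N} (i k : Fin N) → toℕ i ≤ toℕ k → cw i k ≡ toℕ k ∸ toℕ i
cw-≤ i k i≤k with toℕ i ≤ᵇ toℕ k | ≤⇒≤ᵇ i≤k
... | true | _ = refl

cw-> : ∀ {N} (i k : Fin N) → toℕ k < toℕ i → cw {N} i k ≡ N ∸ toℕ i + toℕ k
cw-> i k k<i with toℕ i ≤ᵇ toℕ k | ≤ᵇ⇒≤ (toℕ i) (toℕ k)
... | true  | i≤k = ⊥-elim (<⇒≱ k<i (i≤k _))
... | false | _   = refl

cw-spec : ∀ {N} (a x : Fin N) →
  (toℕ a ≤ toℕ x × toℕ a + cw a x ≡ toℕ x) ⊎ (toℕ x < toℕ a × toℕ a + cw a x ≡ toℕ x + N)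
cw-spec {N} a x with toℕ a ≤? toℕ x
... | yes a≤x = inj₁ (a≤x , trans (cong (toℕ a +_) (cw-≤ a x a≤x)) (m+[n∸m]≡n a≤x))
... | no a≰x = inj₂ (x<a , (begin
      toℕ a + cw a x               ≡⟨ cong (toℕ a +_) (cw-> a x x<a) ⟩
      toℕ a + (N ∸ toℕ a + toℕ x)  ≡⟨ +-assoc (toℕ a) _ _ ⟨
      toℕ a + (N ∸ toℕ a) + toℕ x  ≡⟨ cong (_+ toℕ x) (m+[n∸m]≡n (<⇒≤ (toℕ<n a))) ⟩
      N + toℕ x                    ≡⟨ +-comm N (toℕ x) ⟩
      toℕ x + N                    ∎))
  where
  open ≡-Reasoning
  x<a : toℕ x < toℕ a
  x<a = ≰⇒> a≰x

cw<N : ∀ {N} (i k : Fin N) → cw i k < N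
cw<N {N} i k with cw-spec i k
... | inj₁ (_ , e) = ≤-<-trans (m≤n+m (cw i k) (toℕ i)) (subst (_< N) (sym e) (toℕ<n k))
... | inj₂ (k<i , e) = +-cancelˡ-< (toℕ i) (cw i k) N (subst (_< toℕ i + N) (sym e) (+-monoˡ-< N k<i))

rot-cw : ∀ {N} (i k : Fin N) → rot (cw i k) i ≡ k
rot-cw {suc n} i k with cw-spec i k
... | inj₁ (_ , e) = toℕ-injective (trans (toℕ-rot (cw i k) i)
      (trans (cong (_% suc n) e) (m<n⇒m%n≡m (toℕ<n k))))
... | inj₂ (_ , e) = toℕ-injective (trans (toℕ-rot (cw i k) i)
      (trans (cong (_% suc n) e) (trans ([m+n]%n≡m%n (toℕ k) (suc n)) (m<n⇒m%n≡m (toℕ<n k)))))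

cw-unique : ∀ {N} (i k : Fin N) d → d < N → rot d i ≡ k → cw i k ≡ d
cw-unique {suc n} i k d d<N refl
  with cw-spec i (rot d i) | [m+n]%n-cases (toℕ i) d (suc n) (toℕ<n i) d<N
... | inj₁ (_ , e) | inj₁ (m , _) = +-cancelˡ-≡ (toℕ i) _ _ (trans e (trans (toℕ-rot d i) m))
... | inj₁ (i≤ , e) | inj₂ m = ⊥-elim (<⇒≱ (+-cancelʳ-< _ _ _ lt) i≤)
  where
  lt : toℕ (rot d i) + suc n < toℕ i + suc n
  lt = subst (_< toℕ i + suc n) (trans (sym m) (cong (_+ suc n) (sym (toℕ-rot d i)))) (+-monoʳ-< (toℕ i) d<N)
... | inj₂ (lt , e) | inj₁ (m , _) =
  ⊥-elim (<⇒≱ lt (subst (toℕ i ≤_) (trans (sym m) (sym (toℕ-rot d i))) (m≤m+n (toℕ i) d)))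
... | inj₂ (_ , e) | inj₂ m = +-cancelˡ-≡ (toℕ i) _ _ (trans e (trans (cong (_+ suc n) (toℕ-rot d i)) m))

cw-rot : ∀ {N} (i : Fin N) d → d < N → cw i (rot d i) ≡ d
cw-rot i d d<N = cw-unique i (rot d i) d d<N refl

cw-self : ∀ {N} (x : Fin N) → cw x x ≡ 0
cw-self {suc n} x = cw-unique x x 0 z<s (rot-zero x)

cw≡0⇒≡ : ∀ {N} (x y : Fin N) → cw x y ≡ 0 → x ≡ y
cw≡0⇒≡ x y e = trans (sym (rot-zero x)) (trans (cong (λ d → rot d x) (sym e)) (rot-cw x y))

cw-injectiveʳ : ∀ {N} (k y l : Fin N) → cw k y ≡ cw k l → y ≡ l
cw-injectiveʳ k y l e = trans (sym (rot-cw k y)) (trans (cong (λ d → rot d k) e) (rot-cw k l))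

cw>0 : ∀ {N} (a y : Fin N) → a ≢ y → 0 < cw a y
cw>0 a y a≢y = n≢0⇒n>0 (λ e → a≢y (cw≡0⇒≡ a y e))

cw>0⇒≢ : ∀ {N} {a y : Fin N} → 0 < cw a y → a ≢ y
cw>0⇒≢ {a = a} 0<cw refl = <-irrefl (sym (cw-self a)) 0<cw

≤∧cw>0⇒< : ∀ {N} {a y : Fin N} → toℕ a ≤ toℕ y → 0 < cw a y → toℕ a < toℕ y
≤∧cw>0⇒< a≤y 0<cw = ≤∧≢⇒< a≤y (cw>0⇒≢ 0<cw ∘ toℕ-injective)

rot-cw-cw : ∀ {N} (a b c : Fin N) → rot (cw a b + cw b c) a ≡ c
rot-cw-cw a b c = trans (sym (rot-rot (cw b c) (cw a b) a)) (trans (cong (rot (cw b c)) (rot-cw a b)) (rot-cw b c))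

cw-triangle : ∀ {N} (a b c : Fin N) → cw a b + cw b c ≡ cw a c ⊎ cw a b + cw b c ≡ cw a c + N
cw-triangle {N} a b c with N ≤? cw a b + cw b c
... | no N≰ = inj₁ (sym (cw-unique a c _ (≰⇒> N≰) (rot-cw-cw a b c)))
... | yes N≤ with m≤n⇒∃[o]m+o≡n N≤
... | t , N+t≡ = inj₂ (trans (sym N+t≡) (trans (+-comm N t) (cong (_+ N) (sym (cw-unique a c t t<N rot-t)))))
  where
  t<N : t < N
  t<N = +-cancelˡ-< N t N (subst (_< N + N) (sym N+t≡) (+-mono-< (cw<N a b) (cw<N b c)))
  rot-t : rot t a ≡ c
  rot-t = trans (sym (rot-+N t a)) (trans (cong (λ z → rot z a) (trans (+-comm t N) N+t≡)) (rot-cw-cw a b c))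

cw-triangle-≤ : ∀ {N} (a i x : Fin N) → cw a i ≤ cw a x → cw a i + cw i x ≡ cw a x
cw-triangle-≤ {N} a i x le with cw-triangle a i x
... | inj₁ e = e
... | inj₂ e = ⊥-elim (<⇒≱ (cw<N i x)
      (+-cancelˡ-≤ (cw a i) _ _ (subst (cw a i + N ≤_) (sym e) (+-monoˡ-≤ N le))))

cw-triangle-> : ∀ {N} (a i x : Fin N) → cw a x < cw a i → cw a i + cw i x ≡ cw a x + N
cw-triangle-> a i x lt with cw-triangle a i x
... | inj₁ e = ⊥-elim (<⇒≱ lt (subst (cw a i ≤_) e (m≤m+n _ _)))
... | inj₂ e = e

cw+cw≡N : ∀ {N} (x y : Fin N) → x ≢ y → cw x y + cw y x ≡ N
cw+cw≡N x y x≢y with cw-triangle x y x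
... | inj₁ e = ⊥-elim (x≢y (cw≡0⇒≡ x y (m+n≡0⇒m≡0 _ (trans e (cw-self x)))))
... | inj₂ e = trans e (cong (_+ _) (cw-self x))

cw-invariant : ∀ {N} h (x y : Fin N) → cw (rot h x) (rot h y) ≡ cw x y
cw-invariant h x y = cw-unique (rot h x) (rot h y) (cw x y) (cw<N x y)
  (trans (rot-comm (cw x y) h x) (cong (rot h) (rot-cw x y)))

rot-injective : ∀ {N} h (x y : Fin N) → rot h x ≡ rot h y → x ≡ y
rot-injective h x y e = cw≡0⇒≡ x y (begin
  cw x y                  ≡⟨ cw-invariant h x y ⟨
  cw (rot h x) (rot h y)  ≡⟨ cong (cw (rot h x)) e ⟨
  cw (rot h x) (rot h x)  ≡⟨ cw-self (rot h x) ⟩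
  0                       ∎)
  where open ≡-Reasoning

cw-next : ∀ {N} (a x : Fin N) →
  (cw a (next x) ≡ suc (cw a x) × suc (cw a x) < N) ⊎ (next x ≡ a × suc (cw a x) ≡ N)
cw-next {N} a x with suc (cw a x) <? N
... | yes lt = inj₁ (cw-unique a (next x) (suc (cw a x)) lt rot-suc , lt)
  where
  rot-suc : rot (suc (cw a x)) a ≡ next x
  rot-suc = trans (cong (λ z → rot z a) (+-comm 1 (cw a x)))
    (trans (sym (rot-rot 1 (cw a x) a)) (cong next (rot-cw a x)))
... | no nlt = inj₂ (sym a≡next , suc≡N)
  where
  suc≡N : suc (cw a x) ≡ N
  suc≡N = ≤-antisym (cw<N a x) (≮⇒≥ nlt)
  a≡next : a ≡ next x
  a≡next = begin
    a                      ≡⟨ rot-N a ⟨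
    rot N a                ≡⟨ cong (λ z → rot z a) (trans (sym suc≡N) (+-comm 1 (cw a x))) ⟩
    rot (cw a x + 1) a     ≡⟨ rot-rot 1 (cw a x) a ⟨
    next (rot (cw a x) a)  ≡⟨ cong next (rot-cw a x) ⟩
    next x                 ∎
    where open ≡-Reasoning

cw-next-≢ : ∀ {N} (a x : Fin N) → next x ≢ a → cw a (next x) ≡ suc (cw a x)
cw-next-≢ a x next≢a with cw-next a x
... | inj₁ (e , _) = e
... | inj₂ (e , _) = ⊥-elim (next≢a e)

cw-order : ∀ {N} (a x y : Fin N) → cw a x < cw a y →
  (toℕ a ≤ toℕ x × toℕ x < toℕ y) ⊎ (toℕ a ≤ toℕ x × toℕ y < toℕ a) ⊎ (toℕ x < toℕ y × toℕ y < toℕ a)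
cw-order {N} a x y lt with cw-spec a x | cw-spec a y
... | inj₁ (a≤x , e₁) | inj₁ (_ , e₂) = inj₁ (a≤x , subst₂ _<_ e₁ e₂ (+-monoʳ-< (toℕ a) lt))
... | inj₁ (a≤x , _) | inj₂ (y<a , _) = inj₂ (inj₁ (a≤x , y<a))
... | inj₂ (_ , e₁) | inj₁ (_ , e₂) =
  ⊥-elim (<⇒≱ (toℕ<n y) (≤-trans (m≤n+m N (toℕ x)) (<⇒≤ (subst₂ _<_ e₁ e₂ (+-monoʳ-< (toℕ a) lt)))))
... | inj₂ (_ , e₁) | inj₂ (y<a , e₂) =
  inj₂ (inj₂ (+-cancelʳ-< N _ _ (subst₂ _<_ e₁ e₂ (+-monoʳ-< (toℕ a) lt)) , y<a))

-- Gap g (between bases g and g+1) lies on the arc from base i clockwise to base k.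
OnArc : ∀ {N} → Fin N → Fin N → Fin N → Set
OnArc i k g = cw i g < cw i k

Short : ∀ {N} → Fin N → Fin N → Set
Short {N} i k = 2 * cw i k ≤ N

¬Short⇒Short-opposite : ∀ {N} {i k : Fin N} → i ≢ k → ¬ Short i k → Short k i
¬Short⇒Short-opposite {i = i} {k} i≢k = m+n≡o∧2m≰o⇒2n≤o {cw i k} {cw k i} (cw+cw≡N i k i≢k)

OnArc⇒¬OnArc-opposite : ∀ {N} (k l u : Fin N) → k ≢ l → OnArc k l u → ¬ OnArc l k u
OnArc⇒¬OnArc-opposite {N} k l u k≢l lt lt′ with cw-triangle k l u
... | inj₁ e = <⇒≱ lt (subst (cw k l ≤_) e (m≤m+n _ _))
... | inj₂ e = <⇒≱ lt′ (+-cancelˡ-≤ (cw k l) _ _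
      (subst₂ _≤_ (sym (cw+cw≡N k l k≢l)) (sym e) (subst (N ≤_) (+-comm N (cw k u)) (m≤m+n N _))))

¬OnArc⇒OnArc-opposite : ∀ {N} (k l u : Fin N) → k ≢ l → ¬ OnArc k l u → OnArc l k u
¬OnArc⇒OnArc-opposite {N} k l u k≢l ¬lt with cw-triangle k l u
... | inj₁ e = +-cancelˡ-< (cw k l) _ _ (subst₂ _<_ (sym e) (sym (cw+cw≡N k l k≢l)) (cw<N k u))
... | inj₂ e = ⊥-elim (<⇒≱ (cw<N l u) (+-cancelˡ-≤ (cw k l) _ _
      (subst (cw k l + N ≤_) (sym e) (+-monoˡ-≤ N (≮⇒≥ ¬lt)))))

OnArc⇒Inside : ∀ {N} (i j x : Fin N) → toℕ i < toℕ j → OnArc i j x → Inside i j x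
OnArc⇒Inside {N} i j x i<j lt with cw-spec i x | cw-spec i j
... | inj₁ (i≤x , e₁) | inj₁ (_ , e₂) = i≤x , subst₂ _<_ e₁ e₂ (+-monoʳ-< (toℕ i) lt)
... | _ | inj₂ (j<i , _) = ⊥-elim (<⇒≱ i<j (<⇒≤ j<i))
... | inj₂ (_ , e₁) | inj₁ (_ , e₂) =
  ⊥-elim (<⇒≱ (toℕ<n j) (≤-trans (m≤n+m N (toℕ x)) (<⇒≤ (subst₂ _<_ e₁ e₂ (+-monoʳ-< (toℕ i) lt)))))

Inside⇒OnArc : ∀ {N} (i j x : Fin N) → Inside i j x → OnArc i j x
Inside⇒OnArc i j x (i≤x , x<j) with cw-spec i x | cw-spec i j
... | inj₁ (_ , e₁) | inj₁ (_ , e₂) = +-cancelˡ-< (toℕ i) _ _ (subst₂ _<_ (sym e₁) (sym e₂) x<j)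
... | inj₂ (x<i , _) | _ = ⊥-elim (<⇒≱ x<i i≤x)
... | inj₁ _ | inj₂ (j<i , _) = ⊥-elim (<⇒≱ j<i (≤-trans i≤x (<⇒≤ x<j)))

prev∉arc : ∀ {N} (x l : Fin N) → ¬ OnArc x l (prev x)
prev∉arc x l prev∈ with cw-next x (prev x)
... | inj₁ (e , _) = 0≢1+n (trans (sym (cw-self x)) (trans (cong (cw x) (sym (next-prev x))) e))
... | inj₂ (_ , suc≡N) = <⇒≱ (cw<N x l) (subst (_≤ cw x l) suc≡N prev∈)

Between : ∀ {N} → Fin N → Fin N → Fin N → Set
Between q₁ q₂ x = 0 < cw q₁ x × cw q₁ x ≤ cw q₁ q₂

Between? : ∀ {N} (q₁ q₂ x : Fin N) → Dec (Between q₁ q₂ x)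
Between? q₁ q₂ x = (0 <? cw q₁ x) ×-dec (cw q₁ x ≤? cw q₁ q₂)

¬Between-cases : ∀ {N} (q₁ q₂ x : Fin N) → ¬ Between q₁ q₂ x → cw q₁ x ≡ 0 ⊎ cw q₁ q₂ < cw q₁ x
¬Between-cases q₁ q₂ x x∉ with cw q₁ x ≤? cw q₁ q₂
... | yes x≤q₂ = inj₁ (n≤0⇒n≡0 (≮⇒≥ λ 0<x → x∉ (0<x , x≤q₂)))
... | no x≰q₂ = inj₂ (≰⇒> x≰q₂)

Between-next : ∀ {N} (q₁ q₂ p : Fin N) → p ≢ q₂ → Between q₁ q₂ p → Between q₁ q₂ (next p)
Between-next q₁ q₂ p p≢q₂ (_ , p≤q₂) with cw-next q₁ p
... | inj₁ (e , _) = subst (0 <_) (sym e) z<s ,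
      subst (_≤ cw q₁ q₂) (sym e) (≤∧≢⇒< p≤q₂ (p≢q₂ ∘ cw-injectiveʳ q₁ p q₂))
... | inj₂ (_ , suc≡N) = ⊥-elim (p≢q₂ (cw-injectiveʳ q₁ p q₂
      (≤-antisym p≤q₂ (≤-pred (subst (cw q₁ q₂ <_) (sym suc≡N) (cw<N q₁ q₂))))))

Between-next⁻¹ : ∀ {N} (q₁ q₂ p : Fin N) → p ≢ q₁ → Between q₁ q₂ (next p) → Between q₁ q₂ p
Between-next⁻¹ q₁ q₂ p p≢q₁ (0<next , next≤q₂) with cw-next q₁ p
... | inj₁ (e , _) = cw>0 q₁ p (p≢q₁ ∘ sym) , ≤-trans (n≤1+n _) (subst (_≤ cw q₁ q₂) e next≤q₂)
... | inj₂ (next≡q₁ , _) = ⊥-elim (cw>0⇒≢ 0<next (sym next≡q₁))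

Between-next-self : ∀ {N} (q₁ q₂ : Fin N) → q₁ ≢ q₂ → Between q₁ q₂ (next q₁)
Between-next-self q₁ q₂ q₁≢q₂ with cw-next q₁ q₁
... | inj₁ (e , _) = subst (0 <_) (sym one) z<s , subst (_≤ cw q₁ q₂) (sym one) (cw>0 q₁ q₂ q₁≢q₂)
  where
  one : cw q₁ (next q₁) ≡ 1
  one = trans e (cong suc (cw-self q₁))
... | inj₂ (_ , suc≡N) = ⊥-elim (q₁≢q₂ (cw≡0⇒≡ q₁ q₂ (n<1⇒n≡0
      (subst (cw q₁ q₂ <_) (trans (sym suc≡N) (cong suc (cw-self q₁))) (cw<N q₁ q₂)))))

chord-leaving-arc : ∀ {N} (q₁ q₂ i j : Fin N) → Between q₁ q₂ i →
  cw q₁ j ≡ 0 ⊎ cw q₁ q₂ < cw q₁ j → OnArc i j q₂ × ¬ OnArc i j q₁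
chord-leaving-arc q₁ q₂ i j (0<i , i≤q₂) (inj₁ j≡0) with cw≡0⇒≡ q₁ j j≡0
... | refl = +-cancelˡ-< (cw q₁ i) _ _
               (subst₂ _<_ (sym (cw-triangle-≤ q₁ i q₂ i≤q₂)) (sym (cw+cw≡N q₁ i (cw>0⇒≢ 0<i))) (cw<N q₁ q₂)) ,
             <-irrefl refl
chord-leaving-arc q₁ q₂ i j (0<i , i≤q₂) (inj₂ q₂<j) =
  +-cancelˡ-< (cw q₁ i) _ _ (subst₂ _<_ (sym (cw-triangle-≤ q₁ i q₂ i≤q₂)) (sym i→j) q₂<j) ,
  λ q₁<j → <⇒≱ (cw<N q₁ j) (subst₂ _≤_ (cw+cw≡N q₁ i (cw>0⇒≢ 0<i)) i→j (+-monoʳ-≤ (cw q₁ i) (<⇒≤ q₁<j)))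
  where
  i→j : cw q₁ i + cw i j ≡ cw q₁ j
  i→j = cw-triangle-≤ q₁ i j (≤-trans i≤q₂ (<⇒≤ q₂<j))

Inside? : ∀ {N} (i j x : Fin N) → Dec (Inside i j x)
Inside? i j x = (toℕ i ≤? toℕ x) ×-dec (toℕ x <? toℕ j)

InShortArc? : ∀ {π} (g i k : Pos π) → Dec (InShortArc {π} g i k)
InShortArc? {π} g i k =
  ((2 * cw i k ≤? len π) ×-dec (cw i g <? cw i k)) ⊎-dec ((2 * cw k i ≤? len π) ×-dec (cw k g <? cw k i))

InShortArc-rot⁻¹ : ∀ {π} h (g i k : Pos π) → InShortArc {π} (rot h g) (rot h i) (rot h k) → InShortArc {π} g i k
InShortArc-rot⁻¹ {π} h g i k = Sum.map (arc-rot⁻¹ i k) (arc-rot⁻¹ k i)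
  where
  arc-rot⁻¹ : ∀ i k → Short (rot h i) (rot h k) × OnArc (rot h i) (rot h k) (rot h g) → Short i k × OnArc i k g
  arc-rot⁻¹ i k (short , on) =
    subst (λ d → 2 * d ≤ len π) (cw-invariant h i k) short ,
    subst₂ _<_ (cw-invariant h i g) (cw-invariant h i k) on

-- Loops of a secondary structure

module Loops {π : Ordering} (S : SecStruct π) where

  N : ℕ
  N = len π

  Paired-sym : ∀ {i j} → Paired S i j → Paired S j i
  Paired-sym {i} {j} = SecStruct.sym S i j

  Paired-functional : ∀ {i j k} → Paired S i j → Paired S i k → j ≡ k
  Paired-functional p q = just-injective (trans (sym p) q)

  Paired-irrefl : ∀ {i j} → Paired S i j → i ≢ j
  Paired-irrefl {i} {j} = irrefl S i j

  Separated-sym : ∀ {u w} → Separated S u w → Separated S w u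
  Separated-sym (i , j , p , i<j , inj₁ (u∈ , w∉)) = i , j , p , i<j , inj₂ (w∉ , u∈)
  Separated-sym (i , j , p , i<j , inj₂ (u∉ , w∈)) = i , j , p , i<j , inj₁ (w∈ , u∉)

  SameLoop-sym : ∀ {u w} → SameLoop S u w → SameLoop S w u
  SameLoop-sym same sep = same (Separated-sym sep)

  chord-separates : ∀ {k l} (u w : Pos π) → Paired S k l → OnArc k l u → ¬ OnArc k l w → Separated S u w
  chord-separates {k} {l} u w p u∈ w∉ with <-cmp (toℕ k) (toℕ l)
  ... | tri< k<l _ _ = k , l , p , k<l , inj₁ (OnArc⇒Inside k l u k<l u∈ , λ w∈ → w∉ (Inside⇒OnArc k l w w∈))
  ... | tri≈ _ k≡l _ = ⊥-elim (Paired-irrefl p (toℕ-injective k≡l))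
  ... | tri> _ _ l<k = l , k , Paired-sym p , l<k ,
        inj₂ ((λ u∈′ → OnArc⇒¬OnArc-opposite k l u (Paired-irrefl p) u∈ (Inside⇒OnArc l k u u∈′)) ,
              OnArc⇒Inside l k w l<k (¬OnArc⇒OnArc-opposite k l w (Paired-irrefl p) w∉))

  SameLoop-OnArc : ∀ {k l u w} → SameLoop S u w → Paired S k l → OnArc k l u → OnArc k l w
  SameLoop-OnArc {k} {l} {u} {w} same p u∈ with cw k w <? cw k l
  ... | yes w∈ = w∈
  ... | no w∉ = ⊥-elim (same (chord-separates u w p u∈ w∉))

  OnArc-agree⇒SameLoop : ∀ {u w} →
    (∀ k l → Paired S k l → OnArc k l u → OnArc k l w) →
    (∀ k l → Paired S k l → OnArc k l w → OnArc k l u) → SameLoop S u w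
  OnArc-agree⇒SameLoop {u} {w} u⇒w _ (i , j , p , i<j , inj₁ (u∈ , w∉)) =
    w∉ (OnArc⇒Inside i j w i<j (u⇒w i j p (Inside⇒OnArc i j u u∈)))
  OnArc-agree⇒SameLoop {u} {w} _ w⇒u (i , j , p , i<j , inj₂ (u∉ , w∈)) =
    u∉ (OnArc⇒Inside i j u i<j (w⇒u i j p (Inside⇒OnArc i j w w∈)))

  -- A chord of length exactly N/2 cuts off two short arcs.
  Central : Pos π → Set
  Central g = ∀ i k → Paired S i k → ¬ InShortArc {π} g i k

  Central⇒¬OnShortArc : ∀ {g i k} → Central g → Paired S i k → Short i k → ¬ OnArc i k g
  Central⇒¬OnShortArc {i = i} {k} central p short on = central i k p (inj₁ (short , on))

  Central⇒OnLongArc : ∀ {g i k} → Central g → Paired S i k → ¬ Short i k → OnArc i k g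
  Central⇒OnLongArc {g} {i} {k} central p long = ¬OnArc⇒OnArc-opposite k i g (Paired-irrefl (Paired-sym p))
    (λ on → central i k p (inj₂ (¬Short⇒Short-opposite (Paired-irrefl p) long , on)))

  -- A central gap lies on the long arc of every chord, which fixes its side of every chord.
  Central-SameLoop : ∀ {g u} → Central g → Central u → SameLoop S g u
  Central-SameLoop cg cu = OnArc-agree⇒SameLoop (λ _ _ → transfer cg cu) (λ _ _ → transfer cu cg)
    where
    transfer : ∀ {a b k l} → Central a → Central b → Paired S k l → OnArc k l a → OnArc k l b
    transfer {k = k} {l} ca cb p on with 2 * cw k l ≤? N
    ... | yes short = ⊥-elim (Central⇒¬OnShortArc ca p short on)
    ... | no long = Central⇒OnLongArc cb p long

  SameLoop-Central : ∀ {g u} → Central g → SameLoop S g u → Central u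
  SameLoop-Central cg same i k p (inj₁ (short , on)) =
    cg i k p (inj₁ (short , SameLoop-OnArc (SameLoop-sym same) p on))
  SameLoop-Central cg same i k p (inj₂ (short , on)) =
    cg i k p (inj₂ (short , SameLoop-OnArc (SameLoop-sym same) (Paired-sym p) on))

  Paired? : ∀ i k → Dec (Paired S i k)
  Paired? i k = MP.≡-dec F._≟_ (partner S i) (just k)

  Separated? : ∀ u w → Dec (Separated S u w)
  Separated? u w = FP.any? λ i → FP.any? λ j → Paired? i j ×-dec (toℕ i <? toℕ j) ×-dec
    ((Inside? i j u ×-dec ¬? (Inside? i j w)) ⊎-dec (¬? (Inside? i j u) ×-dec Inside? i j w))

  SameLoop? : ∀ u w → Dec (SameLoop S u w)
  SameLoop? u w = ¬? (Separated? u w)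

  Borders? : ∀ g i → Dec (Borders S g i)
  Borders? g i = FP.any? λ j → Paired? i j ×-dec (toℕ i <? toℕ j) ×-dec (SameLoop? g i ⊎-dec SameLoop? g (prev i))

  UnpairedIn? : ∀ g p → Dec (UnpairedIn S g p)
  UnpairedIn? g p = MP.≡-dec F._≟_ (partner S p) nothing ×-dec SameLoop? g p

  Between-closed : ∀ {q₁ q₂} → ¬ IsBond π q₁ → ¬ IsBond π q₂ → SameLoop S q₁ q₂ →
    ∀ {x y} → Adj S (NoCut {π}) x y → Between q₁ q₂ x → Between q₁ q₂ y
  Between-closed {q₁} {q₂} _ nick₂ _ (bondʳ p bond _) =
    Between-next q₁ q₂ p λ p≡q₂ → nick₂ (subst (IsBond π) p≡q₂ bond)
  Between-closed {q₁} {q₂} nick₁ _ _ (bondˡ p bond _) =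
    Between-next⁻¹ q₁ q₂ p λ p≡q₁ → nick₁ (subst (IsBond π) p≡q₁ bond)
  Between-closed {q₁} {q₂} _ _ same (pair i j pij) i∈ = decidable-stable (Between? q₁ q₂ j) λ j∉ →
    let q₂∈ , q₁∉ = chord-leaving-arc q₁ q₂ i j i∈ (¬Between-cases q₁ q₂ j j∉)
    in same (Separated-sym (chord-separates q₂ q₁ pij q₂∈ q₁∉))

  -- The bases after the nick q₁ up to q₂ are closed under the edges of Poly(S,π): the backbone
  -- stops at the two nicks, and a chord leaving this block would separate q₁ from q₂.
  nicks-in-distinct-loops : Connected S → ∀ {q₁ q₂} → q₁ ≢ q₂ → ¬ IsBond π q₁ → ¬ IsBond π q₂ →
    ¬ SameLoop S q₁ q₂
  nicks-in-distinct-loops con {q₁} {q₂} q₁≢q₂ nick₁ nick₂ same = <-irrefl (sym (cw-self q₁)) (proj₁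
    (Star-preserves (Between q₁ q₂) (Between-closed nick₁ nick₂ same) (con (next q₁) q₁)
      (Between-next-self q₁ q₂ q₁≢q₂)))

  Covered : Pos π → Set
  Covered g = ∃ λ i → ∃ λ k → Paired S i k × Short i k × OnArc i k g

  Central⊎Covered : ∀ g → Central g ⊎ Covered g
  Central⊎Covered g with FP.any? (λ i → FP.any? λ k → Paired? i k ×-dec InShortArc? {π} g i k)
  ... | yes (i , k , p , inj₁ (short , on)) = inj₂ (i , k , p , short , on)
  ... | yes (i , k , p , inj₂ (short , on)) = inj₂ (k , i , Paired-sym p , short , on)
  ... | no uncovered = inj₁ (λ i k p on → uncovered (i , k , p , on))

  Separated-Central⇒Covered : ∀ {g g′} → Central g → Separated S g g′ → Covered g′
  Separated-Central⇒Covered {g} {g′} cg (i , j , p , i<j , side) with 2 * cw i j ≤? N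
  ... | yes short = i , j , p , short , on-short side
    where
    on-short : (Inside i j g × ¬ Inside i j g′) ⊎ (¬ Inside i j g × Inside i j g′) → OnArc i j g′
    on-short (inj₁ (g∈ , _)) = ⊥-elim (Central⇒¬OnShortArc cg p short (Inside⇒OnArc i j g g∈))
    on-short (inj₂ (_ , g′∈)) = Inside⇒OnArc i j g′ g′∈
  ... | no long = j , i , Paired-sym p , ¬Short⇒Short-opposite (Paired-irrefl p) long , on-short side
    where
    on-short : (Inside i j g × ¬ Inside i j g′) ⊎ (¬ Inside i j g × Inside i j g′) → OnArc j i g′
    on-short (inj₁ (_ , g′∉)) = ¬OnArc⇒OnArc-opposite i j g′ (Paired-irrefl p) (g′∉ ∘ OnArc⇒Inside i j g′ i<j)
    on-short (inj₂ (g∉ , _)) = ⊥-elim (g∉ (OnArc⇒Inside i j g i<j (Central⇒OnLongArc cg p long)))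

  -- Defs.InSlice, for an arbitrary set of cut gaps.
  Slice : (Pos π → Set) → Pos π → Set
  Slice cut g = ∃ λ c → ∀ q → SameLoop S g q → ¬ cut q × Star (Adj S cut) c q × Star (Adj S cut) c (next q)

  NoDiameter : Set
  NoDiameter = ∀ i k → Paired S i k → 2 * cw i k ≢ N

  swapped-endpoint⇒diameter : ∀ {x z} t → t < N → Paired S x z → Paired S (rot t x) (rot t z) →
    x ≡ rot t z → 2 * cw x z ≡ N
  swapped-endpoint⇒diameter {x} {z} t t<N p p′ x≡ = begin
    2 * cw x z        ≡⟨ cong (cw x z +_) (+-identityʳ (cw x z)) ⟩
    cw x z + cw x z   ≡⟨ cong (cw x z +_) (trans x→z (sym z→x)) ⟩
    cw x z + cw z x   ≡⟨ cw+cw≡N x z (Paired-irrefl p) ⟩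
    N                 ∎
    where
    open ≡-Reasoning
    x→z : cw x z ≡ t
    x→z = trans (cong (cw x) (Paired-functional p (subst (λ u → Paired S u (rot t x)) (sym x≡) (Paired-sym p′))))
                (cw-rot x t t<N)
    z→x : cw z x ≡ t
    z→x = trans (cong (cw z) x≡) (cw-rot z t t<N)

  rotated-chord-disjoint : NoDiameter → ∀ {x z} t → 0 < t → t < N →
    Paired S x z → Paired S (rot t x) (rot t z) →
    ∀ {m m′} → m ≡ x ⊎ m ≡ z → m′ ≡ rot t x ⊎ m′ ≡ rot t z → m ≢ m′
  rotated-chord-disjoint _ {x} t 0<t t<N _ _ (inj₁ refl) (inj₁ refl) =
    cw>0⇒≢ (subst (0 <_) (sym (cw-rot x t t<N)) 0<t)
  rotated-chord-disjoint no-diameter t _ t<N p p′ (inj₁ refl) (inj₂ refl) =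
    no-diameter _ _ p ∘ swapped-endpoint⇒diameter t t<N p p′
  rotated-chord-disjoint no-diameter t _ t<N p p′ (inj₂ refl) (inj₁ refl) =
    no-diameter _ _ (Paired-sym p) ∘ swapped-endpoint⇒diameter t t<N (Paired-sym p) (Paired-sym p′)
  rotated-chord-disjoint _ {z = z} t 0<t t<N _ _ (inj₂ refl) (inj₂ refl) =
    cw>0⇒≢ (subst (0 <_) (sym (cw-rot z t t<N)) 0<t)

module Rotation {π : Ordering} {S : SecStruct π} (h : ℕ) (inv : Invariant S h) where
  open Loops S

  Paired-rot : ∀ {i j} → Paired S i j → Paired S (rot h i) (rot h j)
  Paired-rot {i} p = trans (inv i) (cong (Maybe.map (rot h)) p)

  unpaired-rot : ∀ {i} → partner S i ≡ nothing → partner S (rot h i) ≡ nothing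
  unpaired-rot {i} p = trans (inv i) (cong (Maybe.map (rot h)) p)

  Paired-rot⁻¹ : ∀ {i j} → Paired S (rot h i) (rot h j) → Paired S i j
  Paired-rot⁻¹ {i} {j} p = unmap (partner S i) (trans (sym (inv i)) p)
    where
    unmap : ∀ m → Maybe.map (rot h) m ≡ just (rot h j) → m ≡ just j
    unmap (just z) e = cong just (rot-injective h z j (just-injective e))

  unrot : Pos π → Pos π
  unrot x = rot (cw (rot h x) x) x

  rot-unrot : ∀ x → rot h (unrot x) ≡ x
  rot-unrot x = trans (rot-comm h _ x) (rot-cw (rot h x) x)

  Central-rot : ∀ {g} → Central g → Central (rot h g)
  Central-rot {g} central i k p on = central (unrot i) (unrot k)
    (Paired-rot⁻¹ (subst₂ (Paired S) (sym (rot-unrot i)) (sym (rot-unrot k)) p))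
    (InShortArc-rot⁻¹ {π} h g (unrot i) (unrot k)
      (subst₂ (InShortArc {π} (rot h g)) (sym (rot-unrot i)) (sym (rot-unrot k)) on))

module NonCrossing {π : Ordering} {S : SecStruct π} (unpk : Unpseudoknotted S) where
  open Loops S

  no-crossing : ∀ {a b y z} → Paired S a b → Paired S y z →
    0 < cw a y → cw a y < cw a b → cw a b < cw a z → ⊥
  no-crossing {a} {b} {y} {z} pab pyz 0<ay ay<ab ab<az with cw-order a y b ay<ab | cw-order a b z ab<az
  ... | inj₁ (a≤y , y<b) | inj₁ (_ , b<z) = unpk a b y z pab pyz (≤∧cw>0⇒< a≤y 0<ay , y<b , b<z)
  ... | inj₁ (a≤y , y<b) | inj₂ (inj₁ (_ , z<a)) = unpk z y a b (Paired-sym pyz) pab (z<a , ≤∧cw>0⇒< a≤y 0<ay , y<b)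
  ... | inj₁ (a≤y , y<b) | inj₂ (inj₂ (b<z , z<a)) = <⇒≱ (<-trans b<z z<a) (≤-trans a≤y (<⇒≤ y<b))
  ... | inj₂ (inj₁ (_ , b<a)) | inj₁ (a≤b , _) = <⇒≱ b<a a≤b
  ... | inj₂ (inj₁ (_ , b<a)) | inj₂ (inj₁ (a≤b , _)) = <⇒≱ b<a a≤b
  ... | inj₂ (inj₁ (a≤y , _)) | inj₂ (inj₂ (b<z , z<a)) =
    unpk b a z y (Paired-sym pab) (Paired-sym pyz) (b<z , z<a , ≤∧cw>0⇒< a≤y 0<ay)
  ... | inj₂ (inj₂ (_ , b<a)) | inj₁ (a≤b , _) = <⇒≱ b<a a≤b
  ... | inj₂ (inj₂ (_ , b<a)) | inj₂ (inj₁ (a≤b , _)) = <⇒≱ b<a a≤b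
  ... | inj₂ (inj₂ (y<b , _)) | inj₂ (inj₂ (b<z , z<a)) = unpk y z b a pyz (Paired-sym pab) (y<b , b<z , z<a)

  SameLoop-prev : ∀ {x y} → Paired S x y → SameLoop S y (prev x)
  SameLoop-prev {x} {y} pxy = OnArc-agree⇒SameLoop forth back
    where
    after : ∀ k → x ≢ k → cw k x ≡ suc (cw k (prev x))
    after k x≢k = trans (cong (cw k) (sym (next-prev x))) (cw-next-≢ k (prev x) (x≢k ∘ trans (sym (next-prev x))))

    forth : ∀ k l → Paired S k l → OnArc k l y → OnArc k l (prev x)
    forth k l pkl y∈ with k F.≟ x | k F.≟ y
    ... | yes refl | _ = ⊥-elim (<-irrefl (cong (cw k) (Paired-functional pxy pkl)) y∈)
    ... | no _ | yes refl rewrite Paired-functional pkl (Paired-sym pxy) =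
      subst (cw k (prev x) <_) (sym (after k (Paired-irrefl pxy))) (n<1+n _)
    ... | no k≢x | no k≢y with cw k (prev x) <? cw k l
    ...   | yes prev∈ = prev∈
    ...   | no prev∉ = ⊥-elim (no-crossing pkl (Paired-sym pxy) (cw>0 k y k≢y) y∈
                         (subst (cw k l <_) (sym (after k (k≢x ∘ sym))) (s≤s (≮⇒≥ prev∉))))

    back : ∀ k l → Paired S k l → OnArc k l (prev x) → OnArc k l y
    back k l pkl prev∈ with k F.≟ x | k F.≟ y
    ... | yes refl | _ = ⊥-elim (prev∉arc k l prev∈)
    ... | no _ | yes refl rewrite Paired-functional pkl (Paired-sym pxy) =
      subst (_< cw k x) (sym (cw-self k)) (cw>0 k x (Paired-irrefl (Paired-sym pxy)))
    ... | no k≢x | no k≢y with cw k y <? cw k l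
    ...   | yes y∈ = y∈
    ...   | no y∉ = ⊥-elim (no-crossing pkl pxy (cw>0 k x k≢x) x∈ l<y)
      where
      x∈ : OnArc k l x
      x∈ = ≤∧≢⇒< (subst (_≤ cw k l) (sym (after k (k≢x ∘ sym))) prev∈)
             (λ e → k≢y (sym (Paired-functional pxy
               (subst (λ u → Paired S u k) (sym (cw-injectiveʳ k x l e)) (Paired-sym pkl)))))
      l<y : cw k l < cw k y
      l<y = ≤∧≢⇒< (≮⇒≥ y∉)
             (λ e → k≢x (Paired-functional (subst (λ u → Paired S u k) (cw-injectiveʳ k l y e) (Paired-sym pkl))
               (Paired-sym pxy)))

  reach-under-chord : ∀ {a b} → Paired S a b → Connected S → (cut : Pos π → Set) →
    (∀ q → cut q → ¬ OnArc a b q) → ∀ x → cw a x ≤ cw a b → Star (Adj S cut) a x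
  reach-under-chord {a} {b} pab con cut uncut x = Star-preserves (λ z → Under z → Reach z) step (con a x) (λ _ → ε)
    where
    Under : Pos π → Set
    Under x = cw a x ≤ cw a b

    Reach : Pos π → Set
    Reach = Star (Adj S cut) a

    reach-b : Reach b
    reach-b = pair a b pab ◅ ε

    reach-next : ∀ {p} → OnArc a b p → (Under (next p) → Reach (next p)) → Reach (next p)
    reach-next {p} p∈ reach with cw-next a p
    ... | inj₁ (e , _) = reach (subst (_≤ cw a b) (sym e) p∈)
    ... | inj₂ (next≡a , _) = subst Reach (sym next≡a) ε

    step : ∀ {z y} → Adj S (NoCut {π}) z y → (Under z → Reach z) → Under y → Reach y
    step (bondʳ p bond _) reach next-under with cw-next a p
    ... | inj₂ (next≡a , _) = subst Reach (sym next≡a) ε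
    ... | inj₁ (e , _) = reach (<⇒≤ p∈) ◅◅ (bondʳ p bond (λ c → uncut p c p∈) ◅ ε)
      where
      p∈ : OnArc a b p
      p∈ = subst (_≤ cw a b) e next-under
    step (bondˡ p bond _) reach p-under with cw a p <? cw a b
    ... | yes p∈ = reach-next p∈ reach ◅◅ (bondˡ p bond (λ c → uncut p c p∈) ◅ ε)
    ... | no p∉ = subst Reach (cw-injectiveʳ a b p (≤-antisym (≮⇒≥ p∉) p-under)) reach-b
    step (pair i j pij) reach j-under with j F.≟ a | j F.≟ b | cw a i ≤? cw a b
    ... | yes refl | _ | _ = ε
    ... | no _ | yes refl | _ = reach-b
    ... | no _ | no _ | yes i-under = reach i-under ◅◅ (pair i j pij ◅ ε)
    ... | no j≢a | no j≢b | no i-over = ⊥-elim (no-crossing pab (Paired-sym pij) (cw>0 a j (j≢a ∘ sym))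
                                          (≤∧≢⇒< j-under (j≢b ∘ cw-injectiveʳ a j b)) (≰⇒> i-over))

  Covered⇒slice : Connected S → (cut : Pos π → Set) → (∀ q → cut q → Central q) → ∀ {g} → Covered g →
    Slice cut g
  Covered⇒slice con cut cut-central (a , b , pab , short , g∈) = a , λ q same →
    let q∈ = SameLoop-OnArc same pab g∈ in uncut q q∈ , reach q (<⇒≤ q∈) , reach-next q q∈
    where
    uncut : ∀ q → OnArc a b q → ¬ cut q
    uncut q q∈ c = Central⇒¬OnShortArc (cut-central q c) pab short q∈

    reach : ∀ x → cw a x ≤ cw a b → Star (Adj S cut) a x
    reach = reach-under-chord pab con cut (λ q c q∈ → uncut q q∈ c)

    reach-next : ∀ q → OnArc a b q → Star (Adj S cut) a (next q)
    reach-next q q∈ with cw-next a q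
    ... | inj₁ (e , _) = reach (next q) (subst (_≤ cw a b) (sym e) q∈)
    ... | inj₂ (next≡a , _) = subst (Star (Adj S cut) a) (sym next≡a) ε

  nested-short-chord : NoDiameter → ∀ {a b k l} → Paired S a b → Short a b → Paired S k l → Short k l →
    OnArc k l b → cw a b < cw k l
  nested-short-chord no-diameter {a} {b} {k} {l} pab short-ab pkl short-kl b∈
    with k F.≟ b | k F.≟ a | cw k a ≤? cw k b | cw k a <? cw k l
  ... | yes refl | _ | _ | _ rewrite Paired-functional pkl (Paired-sym pab) =
    ⊥-elim (no-diameter a b pab
      (m+n≡o∧2m≤o∧2n≤o⇒2m≡o {cw a b} {cw b a} (cw+cw≡N a b (Paired-irrefl pab)) short-ab short-kl))
  ... | no _ | yes refl | _ | _ = ⊥-elim (<-irrefl (cong (cw k) (Paired-functional pab pkl)) b∈)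
  ... | no _ | no _ | yes a≤b | _ = ≤-<-trans (subst (cw a b ≤_) (cw-triangle-≤ k a b a≤b) (m≤n+m _ _)) b∈
  ... | no k≢b | no _ | no _ | no a∉ = ⊥-elim (no-crossing pkl (Paired-sym pab) (cw>0 k b k≢b) b∈
        (≤∧≢⇒< (≮⇒≥ a∉) (λ e → k≢b (Paired-functional (Paired-sym pkl)
          (subst (λ u → Paired S u b) (cw-injectiveʳ k a l (sym e)) pab)))))
  ... | no _ | no _ | no a≰b | yes a∈ =
    ⊥-elim (m+n≡k+o⇒2m≮o∨2n≰o {cw k a} {cw a b} (cw-triangle-> k a b (≰⇒> a≰b))
      (<-≤-trans (*-monoʳ-< 2 a∈) short-kl) short-ab)

  -- Terminates: replacing a short chord (a,b) by a short chord covering b lengthens the short arc.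
  central-chord-from : NoDiameter → ∀ fuel {a b} → Paired S a b → Short a b → N ≤ fuel + cw a b →
    ∃ λ a′ → ∃ λ b′ → Paired S a′ b′ × Central b′
  central-chord-from _ zero {a} {b} _ _ N≤ = ⊥-elim (<⇒≱ (cw<N a b) N≤)
  central-chord-from no-diameter (suc fuel) {a} {b} pab short N≤ with Central⊎Covered b
  ... | inj₁ central = a , b , pab , central
  ... | inj₂ (k , l , pkl , short′ , b∈) = central-chord-from no-diameter fuel pkl short′
        (≤-trans N≤ (subst (_≤ fuel + cw k l) (+-suc fuel (cw a b))
          (+-monoʳ-≤ fuel (nested-short-chord no-diameter pab short pkl short′ b∈))))

  central-chord : NoDiameter → ∀ {x y} → Paired S x y → ∃ λ a → ∃ λ b → Paired S a b × Central b
  central-chord no-diameter {x} {y} pxy with 2 * cw x y ≤? N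
  ... | yes short = central-chord-from no-diameter N pxy short (m≤m+n N _)
  ... | no long = central-chord-from no-diameter N (Paired-sym pxy)
                    (¬Short⇒Short-opposite (Paired-irrefl pxy) long) (m≤m+n N _)

  Central-end-borders : ∀ {g x y} → Central g → Paired S x y → Central y →
    ∃ λ m → Borders S g m × (m ≡ x ⊎ m ≡ y)
  Central-end-borders {g} {x} {y} cg pxy cy with <-cmp (toℕ x) (toℕ y)
  ... | tri< x<y _ _ =
    x , (y , pxy , x<y , inj₂ (Central-SameLoop cg (SameLoop-Central cy (SameLoop-prev pxy)))) , inj₁ refl
  ... | tri≈ _ x≡y _ = ⊥-elim (Paired-irrefl pxy (toℕ-injective x≡y))
  ... | tri> _ _ y<x = y , (x , Paired-sym pxy , y<x , inj₁ (Central-SameLoop cg cy)) , inj₂ refl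

  central-loop-slices : Connected S → ∀ {cut g} → (∀ q → cut q → Central q) → ∃ cut → Central g →
    ¬ Slice cut g × (∀ g′ → ¬ Slice cut g′ → SameLoop S g g′)
  central-loop-slices con {cut} {g} cut-central (q , q-cut) cg = cut-in-loop , outside-in-slice
    where
    cut-in-loop : ¬ Slice cut g
    cut-in-loop (_ , slice) = proj₁ (slice q (Central-SameLoop cg (cut-central q q-cut))) q-cut

    outside-in-slice : ∀ g′ → ¬ Slice cut g′ → SameLoop S g g′
    outside-in-slice g′ ¬slice = decidable-stable (SameLoop? g g′) λ ¬same →
      ¬slice (Covered⇒slice con cut cut-central
        (Separated-Central⇒Covered cg (decidable-stable (Separated? g g′) ¬same)))

-- Periodic strand orderings

lookup? : ∀ {X : Set} → List X → ℕ → Maybe X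
lookup? [] _ = nothing
lookup? (x ∷ _) zero = just x
lookup? (_ ∷ xs) (suc n) = lookup? xs n

lookup?-lookup : ∀ {X : Set} (xs : List X) (i : Fin (length xs)) → lookup? xs (toℕ i) ≡ just (lookup xs i)
lookup?-lookup (_ ∷ _) F.zero = refl
lookup?-lookup (_ ∷ xs) (F.suc i) = lookup?-lookup xs i

lookup?-++ˡ : ∀ {X : Set} (xs ys : List X) {n} → n < length xs → lookup? (xs ++ ys) n ≡ lookup? xs n
lookup?-++ˡ (_ ∷ _) ys {zero} _ = refl
lookup?-++ˡ (_ ∷ xs) ys {suc n} n<len = lookup?-++ˡ xs ys (≤-pred n<len)

lookup?-++ʳ : ∀ {X : Set} (xs ys : List X) n → lookup? (xs ++ ys) (length xs + n) ≡ lookup? ys n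
lookup?-++ʳ [] ys n = refl
lookup?-++ʳ (_ ∷ xs) ys n = lookup?-++ʳ xs ys n

lookup?-concat-replicate : ∀ {X : Set} (xs : List X) .{{_ : NonZero (length xs)}} v n → n < v * length xs →
  lookup? (concat (replicate v xs)) n ≡ lookup? xs (n % length xs)
lookup?-concat-replicate xs (suc v) n n<len with n <? length xs
... | yes n<L = trans (lookup?-++ˡ xs _ n<L) (cong (lookup? xs) (sym (m<n⇒m%n≡m n<L)))
... | no n≮L with m≤n⇒∃[o]m+o≡n (≮⇒≥ n≮L)
... | k , refl = begin
  lookup? (xs ++ concat (replicate v xs)) (length xs + k)  ≡⟨ lookup?-++ʳ xs _ k ⟩
  lookup? (concat (replicate v xs)) k                      ≡⟨ lookup?-concat-replicate xs v k (+-cancelˡ-< (length xs) k _ n<len) ⟩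
  lookup? xs (k % length xs)                               ≡⟨ cong (lookup? xs) ([k+n]%k≡n%k (length xs) k) ⟨
  lookup? xs ((length xs + k) % length xs)                 ∎
  where open ≡-Reasoning

length-concat-replicate : ∀ {X : Set} v (xs : List X) → length (concat (replicate v xs)) ≡ v * length xs
length-concat-replicate zero xs = refl
length-concat-replicate (suc v) xs = trans (length-++ xs) (cong (length xs +_) (length-concat-replicate v xs))

concat²-replicate : ∀ {X : Set} v (xss : List (List X)) →
  concat (concat (replicate v xss)) ≡ concat (replicate v (concat xss))
concat²-replicate v xss = trans (sym (concat-concat (replicate v xss))) (cong concat (map-replicate concat v xss))

concat-replicate-[] : ∀ {X : Set} n → concat {A = X} (replicate n []) ≡ []
concat-replicate-[] zero = refl
concat-replicate-[] (suc n) = concat-replicate-[] n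

len-∷ : ∀ (s : Strand) ys → len (s ∷ ys) ≡ length s + len ys
len-∷ s ys = length-++ s

startsFrom-+ : ∀ a b (ys : Ordering) → startsFrom (a + b) ys ≡ map (a +_) (startsFrom b ys)
startsFrom-+ a b [] = refl
startsFrom-+ a b (s ∷ ys) =
  cong (a + b ∷_) (trans (cong (λ c → startsFrom c ys) (+-assoc a b (length s))) (startsFrom-+ a (b + length s) ys))

startsFrom-shift : ∀ a (ys : Ordering) → startsFrom a ys ≡ map (a +_) (startsFrom 0 ys)
startsFrom-shift a ys = trans (cong (λ c → startsFrom c ys) (sym (+-identityʳ a))) (startsFrom-+ a 0 ys)

startsFrom-++ : ∀ acc (xs ys : Ordering) →
  startsFrom acc (xs ++ ys) ≡ startsFrom acc xs ++ startsFrom (acc + len xs) ys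
startsFrom-++ acc [] ys = cong (λ c → startsFrom c ys) (sym (+-identityʳ acc))
startsFrom-++ acc (s ∷ xs) ys = cong (acc ∷_) (trans (startsFrom-++ (acc + length s) xs ys)
  (cong (λ c → startsFrom (acc + length s) xs ++ startsFrom c ys)
    (trans (+-assoc acc (length s) (len xs)) (cong (acc +_) (sym (len-∷ s xs))))))

startsFrom-< : ∀ acc (ys : Ordering) → All (λ s → 1 ≤ length s) ys →
  ∀ {x} → x ∈ startsFrom acc ys → x < acc + len ys
startsFrom-< acc (s ∷ ys) (1≤s ∷ _) (here refl) =
  subst (acc <_) (trans (+-assoc acc (length s) (len ys)) (cong (acc +_) (sym (len-∷ s ys))))
    (≤-trans (m<m+n acc 1≤s) (m≤m+n _ _))
startsFrom-< acc (s ∷ ys) (_ ∷ strands) {x} (there x∈) =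
  subst (x <_) (trans (+-assoc acc (length s) (len ys)) (cong (acc +_) (sym (len-∷ s ys))))
    (startsFrom-< (acc + length s) ys strands x∈)

0∈startsFrom : ∀ (y : Ordering) → 0 < len y → 0 ∈ startsFrom 0 y
0∈startsFrom (_ ∷ _) _ = here refl

maximal-power-base-nonempty : ∀ {v} (y : Ordering) → (∀ n → IsPower (concat (replicate (suc v) y)) n → n ≤ suc v) →
  All (λ s → 1 ≤ length s) y → 0 < len y
maximal-power-base-nonempty {v} [] maximal _ = ⊥-elim (1+n≰n (maximal (suc (suc v))
  (s≤s z≤n , [] , trans (concat-replicate-[] (suc v)) (sym (concat-replicate-[] (suc (suc v)))))))
maximal-power-base-nonempty (s ∷ ys) _ (1≤s ∷ _) = subst (0 <_) (sym (len-∷ s ys)) (≤-trans 1≤s (m≤m+n _ _))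

module Periodic (y : Ordering) (strands : All (λ s → 1 ≤ length s) y) (0<L : 0 < len y) where

  L : ℕ
  L = len y

  instance
    L-nonZero : NonZero L
    L-nonZero = >-nonZero 0<L

  power : ℕ → Ordering
  power v = concat (replicate v y)

  len-power : ∀ v → len (power v) ≡ v * L
  len-power v = trans (cong length (concat²-replicate v y)) (length-concat-replicate v (concat y))

  ∈-startsFrom-power⁻ : ∀ v {x} → x ∈ startsFrom 0 (power v) → x < v * L × x % L ∈ startsFrom 0 y
  ∈-startsFrom-power⁻ (suc v) {x} x∈ with ∈-++⁻ (startsFrom 0 y) (subst (x ∈_) (startsFrom-++ 0 y (power v)) x∈)
  ... | inj₁ x∈y = ≤-trans (startsFrom-< 0 y strands x∈y) (m≤m+n L _) ,
                   subst (_∈ startsFrom 0 y) (sym (m<n⇒m%n≡m (startsFrom-< 0 y strands x∈y))) x∈y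
  ... | inj₂ x∈rest with ∈-map⁻ (L +_) (subst (x ∈_) (startsFrom-shift L (power v)) x∈rest)
  ... | x′ , x′∈ , refl with ∈-startsFrom-power⁻ v x′∈
  ... | x′<vL , r∈ = +-monoʳ-< L x′<vL , subst (_∈ startsFrom 0 y) (sym ([k+n]%k≡n%k L x′)) r∈

  ∈-startsFrom-power⁺ : ∀ v {x} → x < v * L → x % L ∈ startsFrom 0 y → x ∈ startsFrom 0 (power v)
  ∈-startsFrom-power⁺ (suc v) {x} x<vL r∈ with x <? L
  ... | yes x<L = subst (x ∈_) (sym (startsFrom-++ 0 y (power v)))
                    (∈-++⁺ˡ (subst (_∈ startsFrom 0 y) (m<n⇒m%n≡m x<L) r∈))
  ... | no x≮L with m≤n⇒∃[o]m+o≡n (≮⇒≥ x≮L)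
  ... | k , refl = subst (L + k ∈_) (sym (startsFrom-++ 0 y (power v)))
                     (∈-++⁺ʳ (startsFrom 0 y) (subst (L + k ∈_) (sym (startsFrom-shift L (power v)))
                       (∈-map⁺ (L +_) (∈-startsFrom-power⁺ v (+-cancelˡ-< L k _ x<vL)
                         (subst (_∈ startsFrom 0 y) ([k+n]%k≡n%k L k) r∈)))))

  module _ (v : ℕ) where

    π : Ordering
    π = power v

    residue-rot : ∀ m (i : Pos π) → toℕ (rot (m * L) i) % L ≡ toℕ i % L
    residue-rot m i = begin
      toℕ (rot (m * L) i) % L              ≡⟨ cong (_% L) (toℕ-rot (m * L) i) ⟩
      (toℕ i + m * L) % len π % L          ≡⟨ m∣n⇒o%n%m≡o%m L (len π) (toℕ i + m * L) (divides v (len-power v)) ⟩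
      (toℕ i + m * L) % L                  ≡⟨ [m+kn]%n≡m%n (toℕ i) m L ⟩
      toℕ i % L                            ∎
      where
      open ≡-Reasoning
      instance
        N-nonZero : NonZero (len π)
        N-nonZero = >-nonZero (≤-<-trans z≤n (toℕ<n i))

    lookup?-residue : ∀ (i : Pos π) → lookup? (concat y) (toℕ i % L) ≡ just (baseAt π i)
    lookup?-residue i = begin
      lookup? (concat y) (toℕ i % L)                 ≡⟨ lookup?-concat-replicate (concat y) v (toℕ i) i<vL ⟨
      lookup? (concat (replicate v (concat y))) (toℕ i) ≡⟨ cong (λ xs → lookup? xs (toℕ i)) (concat²-replicate v y) ⟨
      lookup? (concat π) (toℕ i)                     ≡⟨ lookup?-lookup (concat π) i ⟩
      just (baseAt π i)                              ∎
      where
      open ≡-Reasoning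
      i<vL : toℕ i < v * L
      i<vL = subst (toℕ i <_) (len-power v) (toℕ<n i)

    baseAt-rot : ∀ m (i : Pos π) → baseAt π (rot (m * L) i) ≡ baseAt π i
    baseAt-rot m i = just-injective (begin
      just (baseAt π (rot (m * L) i))               ≡⟨ lookup?-residue (rot (m * L) i) ⟨
      lookup? (concat y) (toℕ (rot (m * L) i) % L)  ≡⟨ cong (lookup? (concat y)) (residue-rot m i) ⟩
      lookup? (concat y) (toℕ i % L)                ≡⟨ lookup?-residue i ⟩
      just (baseAt π i)                             ∎)
      where open ≡-Reasoning

    ¬IsBond⇒residue : ∀ q → ¬ IsBond π q → suc (toℕ q) % L ∈ startsFrom 0 y
    ¬IsBond⇒residue q nick with suc (toℕ q) <? len π
    ... | yes q<N = proj₂ (∈-startsFrom-power⁻ v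
                      (decidable-stable (suc (toℕ q) ∈? startsFrom 0 π) (λ q∉ → nick (q<N , q∉))))
    ... | no q≮N = subst (_∈ startsFrom 0 y) (sym (trans (cong (_% L) suc≡vL) (m*n%n≡0 v L))) (0∈startsFrom y 0<L)
      where
      suc≡vL : suc (toℕ q) ≡ v * L
      suc≡vL = trans (≤-antisym (toℕ<n q) (≮⇒≥ q≮N)) (len-power v)

    residue⇒¬IsBond : ∀ q → suc (toℕ q) % L ∈ startsFrom 0 y → ¬ IsBond π q
    residue⇒¬IsBond q r∈ (q<N , q∉) = q∉ (∈-startsFrom-power⁺ v (subst (suc (toℕ q) <_) (len-power v) q<N) r∈)

    nick-rot : ∀ m q → ¬ IsBond π q → ¬ IsBond π (rot (m * L) q)
    nick-rot m q nick = residue⇒¬IsBond (rot (m * L) q)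
      (subst (_∈ startsFrom 0 y) (sym (suc-%-cong L (residue-rot m q))) (¬IsBond⇒residue q nick))

  genStep-power : ∀ v → genStep (power (suc v)) (suc v) ≡ L
  genStep-power v = trans (cong (_/ suc v) (trans (len-power (suc v)) (*-comm (suc v) L))) (m*n/n≡m L (suc v))

  R*step≡len : ∀ v d → suc d ∣ suc v → suc d * (quot (suc v) (suc d) * L) ≡ len (power (suc v))
  R*step≡len v d R∣v = begin
    R * (quot (suc v) R * L)  ≡⟨ *-assoc R (quot (suc v) R) L ⟨
    R * quot (suc v) R * L    ≡⟨ cong (_* L) (*-comm R (quot (suc v) R)) ⟩
    quot (suc v) R * R * L    ≡⟨ cong (_* L) (m/n*n≡m R∣v) ⟩
    suc v * L                 ≡⟨ len-power (suc v) ⟨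
    len (power (suc v))       ∎
    where
    open ≡-Reasoning
    R : ℕ
    R = suc d

  step>0 : ∀ v d → suc d ∣ suc v → 0 < quot (suc v) (suc d) * L
  step>0 v d R∣v = *-mono-< (m≥n⇒m/n>0 (∣⇒≤ R∣v)) 0<L

  Invariant-step : ∀ {v d} {S : SecStruct (power (suc v))} → SubgroupInvariant S (suc v) (suc d) → 1 < suc d →
    Invariant S (quot (suc v) (suc d) * L)
  Invariant-step {v} {d} {S} invariant 1<R = subst (Invariant S)
    (trans (cong (_* genStep (power (suc v)) (suc v)) (*-identityˡ (quot (suc v) (suc d))))
      (cong (quot (suc v) (suc d) *_) (genStep-power v)))
    (invariant 1 1<R)

-- Rotationally symmetric structures

¬Complementary-self : ∀ b → ¬ Complementary b b
¬Complementary-self A ()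
¬Complementary-self C ()
¬Complementary-self G ()
¬Complementary-self T ()

nick-at-end : ∀ π .{{_ : NonZero (len π)}} → ∃ λ (q : Pos π) → ¬ IsBond π q
nick-at-end π =
  fromℕ< pred<N , λ (q<N , _) → <-irrefl (trans (cong suc (toℕ-fromℕ< pred<N)) (suc-pred (len π))) q<N
  where
  pred<N : pred (len π) < len π
  pred<N = subst (pred (len π) <_) (suc-pred (len π)) (n<1+n _)

module Symmetric {π : Ordering} {S : SecStruct π} (unpk : Unpseudoknotted S) (con : Connected S)
  (h r : ℕ) (0<h : 0 < h) (rh≡N : (2 + r) * h ≡ len π) (inv : Invariant S h)
  (base-rot : ∀ i → baseAt π (rot h i) ≡ baseAt π i)
  (nick-rot : ∀ q → ¬ IsBond π q → ¬ IsBond π (rot h q)) where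

  open Loops S
  open NonCrossing {π} {S} unpk
  open Rotation {π} {S} h inv

  h+h≤N : h + h ≤ N
  h+h≤N = subst (h + h ≤_) rh≡N (+-monoʳ-≤ h (m≤m+n h (r * h)))

  h<N : h < N
  h<N = <-≤-trans (m<m+n h 0<h) h+h≤N

  instance
    N-nonZero : NonZero N
    N-nonZero = >-nonZero (<-trans 0<h h<N)

  h+h≡N : r ≡ 0 → h + h ≡ N
  h+h≡N refl = trans (cong (h +_) (sym (+-identityʳ h))) rh≡N

  h+h<N : 0 < r → h + h < N
  h+h<N 0<r = subst (h + h <_) rh≡N
    (+-monoʳ-< h (subst (_< h + r * h) (+-identityʳ h) (+-monoʳ-< h (*-mono-< 0<r 0<h))))

  cw-rot-h : ∀ x → cw x (rot h x) ≡ h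
  cw-rot-h x = cw-rot x h h<N

  rot-h-≢ : ∀ x → x ≢ rot h x
  rot-h-≢ x = cw>0⇒≢ (subst (0 <_) (sym (cw-rot-h x)) 0<h)

  rot-h-twice : r ≡ 0 → ∀ x → rot h (rot h x) ≡ x
  rot-h-twice r≡0 x = trans (rot-rot h h x) (trans (cong (λ t → rot t x) (h+h≡N r≡0)) (rot-N {N} x))

  no-diameter-two-fold : r ≡ 0 → NoDiameter
  no-diameter-two-fold r≡0 i k pik 2ik≡N = ¬Complementary-self (baseAt π i)
    (subst (Complementary (baseAt π i)) (trans (cong (baseAt π) (sym k≡)) (base-rot i)) (compl S i k pik))
    where
    ik≡h : cw i k ≡ h
    ik≡h = *-cancelˡ-≡ (cw i k) h 2 (trans 2ik≡N (trans (sym (h+h≡N r≡0)) (sym (2*n≡n+n h))))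
    k≡ : rot h i ≡ k
    k≡ = trans (cong (λ t → rot t i) (sym ik≡h)) (rot-cw i k)

  no-diameter-many-fold : 0 < r → NoDiameter
  no-diameter-many-fold 0<r i k pik 2ik≡N = no-crossing pik (Paired-rot pik)
    (subst (0 <_) (sym (cw-rot-h i)) 0<h) (subst (_< cw i k) (sym (cw-rot-h i)) h<ik) ik<i-rot-k
    where
    h<ik : h < cw i k
    h<ik = *-cancelˡ-< 2 h (cw i k) (subst₂ _<_ (sym (2*n≡n+n h)) (sym 2ik≡N) (h+h<N 0<r))
    ik+h<N : cw i k + h < N
    ik+h<N = subst (cw i k + h <_) (trans (sym (2*n≡n+n (cw i k))) 2ik≡N) (+-monoʳ-< (cw i k) h<ik)
    ik<i-rot-k : cw i k < cw i (rot h k)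
    ik<i-rot-k with cw-triangle i k (rot h k)
    ... | inj₁ e = subst (cw i k <_) (trans (cong (cw i k +_) (sym (cw-rot-h k))) e) (m<m+n (cw i k) 0<h)
    ... | inj₂ e = ⊥-elim (<⇒≱ ik+h<N (subst (N ≤_) (trans (sym e) (cong (cw i k +_) (cw-rot-h k))) (m≤n+m N _)))

  no-diameter : NoDiameter
  no-diameter with r ≟ 0
  ... | yes r≡0 = no-diameter-two-fold r≡0
  ... | no r≢0 = no-diameter-many-fold (n≢0⇒n>0 r≢0)

  some-chord : ∃ λ i → ∃ λ j → Paired S i j
  some-chord = decidable-stable (FP.any? λ i → FP.any? λ j → Paired? i j) λ no-chord →
    nicks-in-distinct-loops con (rot-h-≢ end) end-nick (nick-rot end end-nick)
      λ (i , j , p , _) → no-chord (i , j , p)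
    where
    end : Pos π
    end = proj₁ (nick-at-end π)
    end-nick : ¬ IsBond π end
    end-nick = proj₂ (nick-at-end π)

  Central⇒¬HasNick : ∀ {g} → Central g → ¬ HasNick S g
  Central⇒¬HasNick cg (q , same , nick) =
    nicks-in-distinct-loops con (rot-h-≢ q) nick (nick-rot q nick) (Central-SameLoop cq (Central-rot cq))
    where
    cq : Central q
    cq = SameLoop-Central cg same

  UnpairedIn-rot : ∀ {g u} → Central g → UnpairedIn S g u → UnpairedIn S g (rot h u)
  UnpairedIn-rot cg (free , same) = unpaired-rot free , Central-SameLoop cg (Central-rot (SameLoop-Central cg same))

  -- A run from x to its half-turn image, together with its own image, covers the whole circle.
  run-to-half-turn⇒all-free : r ≡ 0 → ∀ {g x} → RunCW S g x (rot h x) → ∀ y → partner S y ≡ nothing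
  run-to-half-turn⇒all-free r≡0 {g} {x} (k , rot-k≡ , run) =
    covered λ t t≤h → proj₁ (run t (≤-trans t≤h h≤k))
    where
    h≤k : h ≤ k
    h≤k = ≮⇒≥ λ k<h →
      <-irrefl (trans (sym (cw-rot x k (<-trans k<h h<N))) (trans (cong (cw x) rot-k≡) (cw-rot-h x))) k<h

    Free : Pos π → Set
    Free y = partner S y ≡ nothing

    covered : (∀ t → t ≤ h → Free (rot t x)) → ∀ y → Free y
    covered free y with cw x y ≤? h
    ... | yes ≤h = subst Free (rot-cw x y) (free (cw x y) ≤h)
    ... | no ≰h = subst Free rot-back (unpaired-rot (free (cw x y ∸ h) ∸h≤h))
      where
      ∸h≤h : cw x y ∸ h ≤ h
      ∸h≤h = ≤-trans (∸-monoˡ-≤ h (<⇒≤ (subst (cw x y <_) (sym (h+h≡N r≡0)) (cw<N x y))))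
        (≤-reflexive (m+n∸n≡m h h))
      rot-back : rot h (rot (cw x y ∸ h) x) ≡ y
      rot-back = trans (rot-rot h (cw x y ∸ h) x)
        (trans (cong (λ t → rot t x) (m∸n+n≡m (<⇒≤ (≰⇒> ≰h)))) (rot-cw x y))

  module CentralChord {a b} (pab : Paired S a b) (cb : Central b) where

    border₁ : ∃ λ m → Borders S b m × (m ≡ a ⊎ m ≡ b)
    border₁ = Central-end-borders cb pab cb

    border₂ : ∃ λ m → Borders S b m × (m ≡ rot h a ⊎ m ≡ rot h b)
    border₂ = Central-end-borders cb (Paired-rot pab) (Central-rot cb)

    border₃ : ∃ λ m → Borders S b m × (m ≡ rot h (rot h a) ⊎ m ≡ rot h (rot h b))
    border₃ = Central-end-borders cb (Paired-rot (Paired-rot pab)) (Central-rot (Central-rot cb))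

    m₁ m₂ m₃ : Pos π
    m₁ = proj₁ border₁
    m₂ = proj₁ border₂
    m₃ = proj₁ border₃

    m₁≢m₂ : m₁ ≢ m₂
    m₁≢m₂ = rotated-chord-disjoint no-diameter h 0<h h<N pab (Paired-rot pab)
      (proj₂ (proj₂ border₁)) (proj₂ (proj₂ border₂))

    m₂≢m₃ : m₂ ≢ m₃
    m₂≢m₃ = rotated-chord-disjoint no-diameter h 0<h h<N (Paired-rot pab) (Paired-rot (Paired-rot pab))
      (proj₂ (proj₂ border₂)) (proj₂ (proj₂ border₃))

    m₁≢m₃ : 0 < r → m₁ ≢ m₃
    m₁≢m₃ 0<r = rotated-chord-disjoint no-diameter (h + h) (<-≤-trans 0<h (m≤m+n h h)) (h+h<N 0<r) pab
      (subst₂ (Paired S) (rot-rot h h a) (rot-rot h h b) (Paired-rot (Paired-rot pab)))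
      (proj₂ (proj₂ border₁))
      (Sum.map (λ e → trans e (rot-rot h h a)) (λ e → trans e (rot-rot h h b)) (proj₂ (proj₂ border₃)))

    multiloop : 0 < r → Multiloop S b
    multiloop 0<r = (m₁ , m₂ , m₃ , m₁≢m₂ , m₁≢m₃ 0<r , m₂≢m₃ ,
      proj₁ (proj₂ border₁) , proj₁ (proj₂ border₂) , proj₁ (proj₂ border₃)) , Central⇒¬HasNick cb

    multiloop⊎exactly-two : Multiloop S b ⊎ ExactlyTwoPairs S b
    multiloop⊎exactly-two = by-third-border (FP.any? λ i → Borders? b i ×-dec ¬? (i F.≟ m₁) ×-dec ¬? (i F.≟ m₂))
      where
      by-third-border : Dec (∃ λ i → Borders S b i × i ≢ m₁ × i ≢ m₂) → Multiloop S b ⊎ ExactlyTwoPairs S b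
      by-third-border (yes (i , bi , i≢m₁ , i≢m₂)) = inj₁ ((m₁ , m₂ , i , m₁≢m₂ , i≢m₁ ∘ sym , i≢m₂ ∘ sym ,
        proj₁ (proj₂ border₁) , proj₁ (proj₂ border₂) , bi) , Central⇒¬HasNick cb)
      by-third-border (no no-third) = inj₂ (m₁ , m₂ , m₁≢m₂ , proj₁ (proj₂ border₁) , proj₁ (proj₂ border₂) ,
        λ i bi → decidable-stable ((i F.≟ m₁) ⊎-dec (i F.≟ m₂)) λ neither →
          no-third (i , bi , neither ∘ inj₁ , neither ∘ inj₂))

    a-paired : partner S a ≢ nothing
    a-paired free with trans (sym pab) free
    ... | ()

    opposite-sides : r ≡ 0 → ∀ u → ¬ SameSide S b u (rot h u)
    opposite-sides r≡0 u (inj₁ run) = a-paired (run-to-half-turn⇒all-free r≡0 run a)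
    opposite-sides r≡0 u (inj₂ run) =
      a-paired (run-to-half-turn⇒all-free r≡0 (subst (RunCW S b (rot h u)) (sym (rot-h-twice r≡0 u)) run) a)

    two-fold : r ≡ 0 → Multiloop S b ⊎ Stack S b ⊎ InternalLoop S b
    two-fold r≡0 with multiloop⊎exactly-two | FP.any? (UnpairedIn? b)
    ... | inj₁ multi | _ = inj₁ multi
    ... | inj₂ two | no none = inj₂ (inj₁ (two , Central⇒¬HasNick cb , λ u free → none (u , free)))
    ... | inj₂ two | yes (u , free) = inj₂ (inj₂ (two , Central⇒¬HasNick cb ,
          u , rot h u , free , UnpairedIn-rot cb free , opposite-sides r≡0 u))

  central-loop : ∃ λ b → Central b × (0 < r → Multiloop S b) × (r ≡ 0 → Multiloop S b ⊎ Stack S b ⊎ InternalLoop S b)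
  central-loop =
    let _ , b , pab , cb = central-chord no-diameter (proj₂ (proj₂ some-chord))
    in b , cb , CentralChord.multiloop pab cb , CentralChord.two-fold pab cb

lemma4 : (π : Ordering) (v : ℕ) → IsV π v → All (λ s → 1 ≤ length s) π →
    (S : SecStruct π) (R : ℕ) → 2 ≤ R → RFold S v R →
    Connected S → Unpseudoknotted S →
    ∃ λ (g : Pos π) →
      (∀ b → Admissible S v R b →
        ¬ InSlice S v R b g × (∀ g′ → ¬ InSlice S v R b g′ → SameLoop S g g′))
      × (2 < R → Multiloop S g)
      × (R ≡ 2 → Multiloop S g ⊎ Stack S g ⊎ InternalLoop S g)
lemma4 .(concat (replicate (suc v) y)) (suc v) ((s≤s z≤n , y , refl) , maximal) strands
  S (suc (suc r)) (s≤s (s≤s z≤n)) (R∣v , invariant , _) con unpk =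
  let b , central , multiloop , two-fold = central-loop in
  b , (λ b₀ (_ , admissible) → central-loop-slices con admissible (b₀ , 0 , z<s , sym (rot-zero b₀)) central) ,
  multiloop ∘ ≤-pred ∘ ≤-pred , two-fold ∘ suc-injective ∘ suc-injective
  where
  open NonCrossing {S = S} unpk

  y-strands : All (λ s → 1 ≤ length s) y
  y-strands = ++⁻ˡ y strands

  open Periodic y y-strands (maximal-power-base-nonempty y maximal y-strands)

  m : ℕ
  m = quot (suc v) (suc (suc r))

  open Symmetric unpk con (m * L) r (step>0 v (suc r) R∣v) (R*step≡len v (suc r) R∣v)
    (Invariant-step {v} {suc r} {S} invariant (s≤s (s≤s z≤n))) (baseAt-rot (suc v) m) (nick-rot (suc v) m)
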